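{- Let $T$ be a compressed monoidal signature, let $K$ be a string graph, and let $G$ and $H$ be subgraphs of $K$ (with typing morphisms the restrictions of that of $K$) that are themselves string graphs. Then $G \cap H$ and $G \cup H$ (with the restricted typings) are both string graphs.
   Context: Graphs are finite directed multigraphs; $\mathbf{Graph}/\mathcal{G}$ denotes graphs with a typing morphism to $\mathcal{G}$. A compressed monoidal signature $T = (O,M,\mathrm{dom},\mathrm{cod})$ consists of sets $O,M$ and functions $\mathrm{dom},\mathrm{cod} : M \rightarrow (O \times \{\mathsf{v},\mathsf{f}\})^*$ into finite lists. Its derived compressed typegraph $\mathcal{G}_T$ has vertex set $O \sqcup M$, a self-loop on each $X \in O$, for each $f\in M$ and each index $i$ of $\mathrm{dom}(f)$ with $\mathrm{dom}(f)[i]=(X,a)$ an edge $\mathrm{in}^a_{f,i}$ from $X$ to $f$, and for each index $j$ of $\mathrm{cod}(f)$ with $\mathrm{cod}(f)[j]=(X,a)$ an edge $\mathrm{out}^a_{f,j}$ from $f$ to $X$. Vertices typed in $O$ are wire-vertices, those typed in $M$ node-vertices; an edge is fixed-arity if its type is tagged $\mathsf{f}$. A morphism of $\mathcal{G}_T$-typed graphs (including a typing morphism) is arity-matching if for each node-vertex $v$ of the domain it restricts to a bijection from the fixed-arity edges incident to $v$ onto the fixed-arity edges incident to the image of $v$. A string graph is a finite $\mathcal{G}_T$-typed graph whose typing morphism is arity-matching and in which every wire-vertex has at most one incoming and at most one outgoing edge. -}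

module Defs where

open import Data.Nat using (ℕ)
open import Data.Fin using (Fin)
open import Data.Fin.Subset using (Subset; _∈_; _∩_; _∪_) public
open import Data.List using (List; length; lookup)
open import Data.Product using (Σ; _×_; _,_; proj₁; proj₂)
open import Data.Sum using (_⊎_; inj₁; inj₂)
open import Data.Empty using (⊥)
open import Relation.Binary.PropositionalEquality using (_≡_)

-- Tags: variable-arity (v) or fixed-arity (f)
data Tag : Set where
  vTag fTag : Tag

record Signature : Set₁ where
  field
    O   : Set
    M   : Set
    dom : M → List (O × Tag)
    cod : M → List (O × Tag)
open Signature public

module TypeGraph (T : Signature) where
  TV : Set
  TV = O T ⊎ M T

  data TE : Set where
    loop : O T → TE
    inE  : (m : M T) → Fin (length (dom T m)) → TE
    outE : (m : M T) → Fin (length (cod T m)) → TE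

  tsrc : TE → TV
  tsrc (loop X)  = inj₁ X
  tsrc (inE m i) = inj₁ (proj₁ (lookup (dom T m) i))
  tsrc (outE m j) = inj₂ m

  ttgt : TE → TV
  ttgt (loop X)  = inj₁ X
  ttgt (inE m i) = inj₂ m
  ttgt (outE m j) = inj₁ (proj₁ (lookup (cod T m) j))

  FixedT : TE → Set
  FixedT (loop X)   = ⊥
  FixedT (inE m i)  = proj₂ (lookup (dom T m) i) ≡ fTag
  FixedT (outE m j) = proj₂ (lookup (cod T m) j) ≡ fTag

  IncidentT : TE → TV → Set
  IncidentT t x = (tsrc t ≡ x) ⊎ (ttgt t ≡ x)

  record TypedGraph : Set where
    field
      V    : ℕ
      E    : ℕ
      src  : Fin E → Fin V
      tgt  : Fin E → Fin V
      τV   : Fin V → TV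
      τE   : Fin E → TE
      src-hom : ∀ e → τV (src e) ≡ tsrc (τE e)
      tgt-hom : ∀ e → τV (tgt e) ≡ ttgt (τE e)
  open TypedGraph public

  module _ (K : TypedGraph) where
    -- a subgraph of K: a subset of vertices and of edges, closed under src/tgt;
    -- its typing morphism is the restriction of that of K
    IsSubgraph : Subset (V K) → Subset (E K) → Set
    IsSubgraph SV SE = ∀ e → e ∈ SE → (src K e ∈ SV) × (tgt K e ∈ SV)

    Incident : Fin (E K) → Fin (V K) → Set
    Incident e v = (src K e ≡ v) ⊎ (tgt K e ≡ v)

    Fixed : Fin (E K) → Set
    Fixed e = FixedT (τE K e)

    -- the (restricted) typing morphism is arity-matching: for each node-vertex v
    -- it restricts to a bijection from the fixed-arity edges of the subgraph
    -- incident to v onto the fixed-arity edges of G_T incident to τV v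
    ArityMatching : Subset (V K) → Subset (E K) → Set
    ArityMatching SV SE = ∀ v → v ∈ SV → (m : M T) → τV K v ≡ inj₂ m →
      (∀ e → e ∈ SE → Incident e v → Fixed e → FixedT (τE K e) × IncidentT (τE K e) (τV K v))
      × (∀ e e′ → e ∈ SE → e′ ∈ SE → Incident e v → Incident e′ v → Fixed e → Fixed e′ →
           τE K e ≡ τE K e′ → e ≡ e′)
      × (∀ t → FixedT t → IncidentT t (τV K v) →
           Σ (Fin (E K)) λ e → (e ∈ SE) × Incident e v × Fixed e × (τE K e ≡ t))

    WireCondition : Subset (V K) → Subset (E K) → Set
    WireCondition SV SE = ∀ v → v ∈ SV → (X : O T) → τV K v ≡ inj₁ X →
      (∀ e e′ → e ∈ SE → e′ ∈ SE → tgt K e ≡ v → tgt K e′ ≡ v → e ≡ e′)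
      × (∀ e e′ → e ∈ SE → e′ ∈ SE → src K e ≡ v → src K e′ ≡ v → e ≡ e′)

    IsStringSubgraph : Subset (V K) → Subset (E K) → Set
    IsStringSubgraph SV SE = IsSubgraph SV SE × ArityMatching SV SE × WireCondition SV SE

  open import Data.Fin.Subset using (⊤)

  IsStringGraph : TypedGraph → Set
  IsStringGraph K = IsStringSubgraph K ⊤ ⊤

module Submission where

-- Being a string subgraph (SV, SE) of K is a conjunction of three conditions,
-- and each behaves simply under shrinking or enlarging (SV, SE):
--   * closure under source/target is preserved by both ∩ and ∪;
--   * the wire condition and the injectivity half of arity-matching only
--     forbid configurations of edges, so they pass to every smaller subgraph,
--     in particular from K itself to G ∩ H and G ∪ H;
--   * the well-definedness half of arity-matching holds in every typed graph,
--     since a typing morphism maps incident edges to incident edges;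
--   * the surjectivity half asks for witnesses, so it passes to every larger
--     edge set (giving the case G ∪ H); for G ∩ H the witnesses found in G
--     and in H have the same type at the same node-vertex, hence coincide by
--     injectivity in K and lie in G ∩ H.

open import Defs
open import Data.Fin using (Fin)
open import Data.Fin.Subset using (_⊆_; ⊤)
open import Data.Fin.Subset.Properties
  using (⊆⊤; ∈⊤; p∩q⊆p; p∩q⊆q; p⊆p∪q; q⊆p∪q; x∈p∩q⁺; x∈p∩q⁻; x∈p∪q⁺; x∈p∪q⁻)
open import Data.Product using (Σ; _×_; _,_; proj₁; proj₂)
open import Data.Sum using (_⊎_; inj₁; inj₂)
open import Relation.Binary.PropositionalEquality using (_≡_; refl; sym; trans; cong)

module StringSubgraphs (T : Signature) (K : TypeGraph.TypedGraph T) where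
  open TypeGraph T

  ArityInjectiveAt : Subset (E K) → Fin (V K) → Set
  ArityInjectiveAt SE v = ∀ e e′ → e ∈ SE → e′ ∈ SE →
    Incident K e v → Incident K e′ v → Fixed K e → Fixed K e′ →
    τE K e ≡ τE K e′ → e ≡ e′

  AritySurjectiveAt : Subset (E K) → Fin (V K) → Set
  AritySurjectiveAt SE v = ∀ t → FixedT t → IncidentT t (τV K v) →
    Σ (Fin (E K)) λ e → (e ∈ SE) × Incident K e v × Fixed K e × (τE K e ≡ t)

  -- A typing morphism sends an edge incident to v to one incident to τV v;
  -- this is the well-definedness half of arity-matching, valid for all subgraphs.
  incident-typed : ∀ {e v} → Incident K e v → IncidentT (τE K e) (τV K v)
  incident-typed {e} (inj₁ src≡v) = inj₁ (trans (sym (src-hom K e)) (cong (τV K) src≡v))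
  incident-typed {e} (inj₂ tgt≡v) = inj₂ (trans (sym (tgt-hom K e)) (cong (τV K) tgt≡v))

  arityMatching-intro : ∀ {SV SE} →
    (∀ v → v ∈ SV → (m : M T) → τV K v ≡ inj₂ m →
      ArityInjectiveAt SE v × AritySurjectiveAt SE v) →
    ArityMatching K SV SE
  arityMatching-intro parts v v∈SV m node =
    (λ e _ inc fixed → fixed , incident-typed inc) , parts v v∈SV m node

  arity-injective : ∀ {SV SE v m} → ArityMatching K SV SE →
    v ∈ SV → τV K v ≡ inj₂ m → ArityInjectiveAt SE v
  arity-injective {v = v} {m} am v∈SV node = proj₁ (proj₂ (am v v∈SV m node))

  arity-surjective : ∀ {SV SE v m} → ArityMatching K SV SE →
    v ∈ SV → τV K v ≡ inj₂ m → AritySurjectiveAt SE v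
  arity-surjective {v = v} {m} am v∈SV node = proj₂ (proj₂ (am v v∈SV m node))

  injective-mono : ∀ {SE SE′ v} → SE′ ⊆ SE →
    ArityInjectiveAt SE v → ArityInjectiveAt SE′ v
  injective-mono SE′⊆SE inj e e′ e∈ e′∈ = inj e e′ (SE′⊆SE e∈) (SE′⊆SE e′∈)

  surjective-mono : ∀ {SE SE′ v} → SE ⊆ SE′ →
    AritySurjectiveAt SE v → AritySurjectiveAt SE′ v
  surjective-mono SE⊆SE′ surj t fixed inc with surj t fixed inc
  ... | e , e∈SE , rest = e , SE⊆SE′ e∈SE , rest

  -- Witnesses of the same type in GE and in HE coincide when fixed-arity edges
  -- at v are determined by their type in K, so surjectivity passes to GE ∩ HE.
  surjective-∩ : ∀ {GE HE v} → ArityInjectiveAt ⊤ v →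
    AritySurjectiveAt GE v → AritySurjectiveAt HE v → AritySurjectiveAt (GE ∩ HE) v
  surjective-∩ injK surjG surjH t fixed inc
    with surjG t fixed inc | surjH t fixed inc
  ... | e , e∈GE , inc-e , fixed-e , type-e | e′ , e′∈HE , inc-e′ , fixed-e′ , type-e′
    with injK e e′ ∈⊤ ∈⊤ inc-e inc-e′ fixed-e fixed-e′ (trans type-e (sym type-e′))
  ... | refl = e , x∈p∩q⁺ (e∈GE , e′∈HE) , inc-e , fixed-e , type-e

  wire-mono : ∀ {SV SE SV′ SE′} → SV′ ⊆ SV → SE′ ⊆ SE →
    WireCondition K SV SE → WireCondition K SV′ SE′
  wire-mono SV′⊆SV SE′⊆SE wire v v∈ X wireVertex =
    (λ e e′ e∈ e′∈ → proj₁ (wire v (SV′⊆SV v∈) X wireVertex) e e′ (SE′⊆SE e∈) (SE′⊆SE e′∈))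
    , (λ e e′ e∈ e′∈ → proj₂ (wire v (SV′⊆SV v∈) X wireVertex) e e′ (SE′⊆SE e∈) (SE′⊆SE e′∈))

  subgraph-∩ : ∀ {GV HV GE HE} → IsSubgraph K GV GE → IsSubgraph K HV HE →
    IsSubgraph K (GV ∩ HV) (GE ∩ HE)
  subgraph-∩ {GE = GE} {HE} subG subH e e∈ with x∈p∩q⁻ GE HE e∈
  ... | e∈GE , e∈HE =
    x∈p∩q⁺ (proj₁ (subG e e∈GE) , proj₁ (subH e e∈HE))
    , x∈p∩q⁺ (proj₂ (subG e e∈GE) , proj₂ (subH e e∈HE))

  subgraph-∪ : ∀ {GV HV GE HE} → IsSubgraph K GV GE → IsSubgraph K HV HE →
    IsSubgraph K (GV ∪ HV) (GE ∪ HE)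
  subgraph-∪ {GE = GE} {HE} subG subH e e∈ with x∈p∪q⁻ GE HE e∈
  ... | inj₁ e∈GE = x∈p∪q⁺ (inj₁ (proj₁ (subG e e∈GE))) , x∈p∪q⁺ (inj₁ (proj₂ (subG e e∈GE)))
  ... | inj₂ e∈HE = x∈p∪q⁺ (inj₂ (proj₁ (subH e e∈HE))) , x∈p∪q⁺ (inj₂ (proj₂ (subH e e∈HE)))

  arity-∩ : ∀ {GV HV GE HE} → ArityMatching K ⊤ ⊤ →
    ArityMatching K GV GE → ArityMatching K HV HE → ArityMatching K (GV ∩ HV) (GE ∩ HE)
  arity-∩ {GV} {HV} amK amG amH = arityMatching-intro λ v v∈ _ node →
    let injK = arity-injective amK ∈⊤ node in
    injective-mono ⊆⊤ injK
    , surjective-∩ injK (arity-surjective amG (p∩q⊆p GV HV v∈) node)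
                        (arity-surjective amH (p∩q⊆q GV HV v∈) node)

  arity-∪ : ∀ {GV HV GE HE} → ArityMatching K ⊤ ⊤ →
    ArityMatching K GV GE → ArityMatching K HV HE → ArityMatching K (GV ∪ HV) (GE ∪ HE)
  arity-∪ {GV} {HV} {GE} {HE} amK amG amH = arityMatching-intro λ v v∈ _ node →
    injective-mono ⊆⊤ (arity-injective amK ∈⊤ node) , surjective v node (x∈p∪q⁻ GV HV v∈)
    where
    surjective : ∀ {m} v → τV K v ≡ inj₂ m → v ∈ GV ⊎ v ∈ HV → AritySurjectiveAt (GE ∪ HE) v
    surjective v node (inj₁ v∈GV) = surjective-mono (p⊆p∪q HE) (arity-surjective amG v∈GV node)
    surjective v node (inj₂ v∈HV) = surjective-mono (q⊆p∪q GE HE) (arity-surjective amH v∈HV node)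

proposition3p18 : (T : Signature) → let open TypeGraph T in
    (K : TypedGraph) → IsStringGraph K →
    (GV HV : Subset (V K)) (GE HE : Subset (E K)) →
    IsStringSubgraph K GV GE → IsStringSubgraph K HV HE →
    IsStringSubgraph K (GV ∩ HV) (GE ∩ HE) × IsStringSubgraph K (GV ∪ HV) (GE ∪ HE)
proposition3p18 T K (_ , amK , wireK) GV HV GE HE (subG , amG , _) (subH , amH , _) =
  (subgraph-∩ subG subH , arity-∩ amK amG amH , wire-mono ⊆⊤ ⊆⊤ wireK)
  , (subgraph-∪ subG subH , arity-∪ amK amG amH , wire-mono ⊆⊤ ⊆⊤ wireK)
  where open StringSubgraphs T K
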